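{- The following problem is $\texttt{coRE}$-hard: given a HyperLTL formula $\varphi$ of the form $\forall\pi\exists\pi_1\ldots\exists\pi_k\mathpunct{.}(\mathsf{G}\,\phi)\wedge\phi'$, where $\phi$ uses no temporal operator other than (possibly nested) $\mathsf{X}$ and $\phi'$ contains no temporal operators, decide whether there exists a non-empty set of traces $T$ with $T\models\varphi$.
   Context: Fix a finite set $\mathit{AP}$ of atomic propositions and $\Sigma=2^{\mathit{AP}}$; traces are elements of $\Sigma^\omega$. HyperLTL formulas: $\varphi ::= \exists\pi\mathpunct{.}\varphi \mid \forall\pi\mathpunct{.}\varphi \mid \phi$, $\phi ::= a_\pi \mid \neg\phi\mid\phi\wedge\phi\mid\mathsf{X}\phi\mid\phi\,\mathsf{U}\,\phi$ (closed), with $\mathsf{F}\phi=\top\mathsf{U}\phi$, $\mathsf{G}\phi=\neg\mathsf{F}\neg\phi$. Semantics w.r.t. a set of traces $T$ and trace assignment $\Pi$: $\Pi\models_T a_\pi$ iff $a\in\Pi(\pi)(0)$; Boolean connectives as usual; $\mathsf{X}$, $\mathsf{U}$ interpreted as in LTL by shifting all assigned traces synchronously; quantifiers range over $T$. $T\models\varphi$ iff $\varphi$ holds under the empty assignment. -}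

module Defs where

open import Data.Nat using (ℕ; zero; suc; _+_; _≤_; _<_)
open import Data.Fin using (Fin; zero; suc)
open import Data.Bool using (Bool; true)
open import Data.Maybe using (Maybe; just; nothing)
open import Data.Product using (Σ; _×_; _,_)
open import Relation.Binary.PropositionalEquality using (_≡_)
open import Relation.Nullary using (¬_)
open import Function.Bundles using (_⇔_)
open import Level using (Level) renaming (suc to lsuc; zero to lzero)

-- letters Σ = 2^AP, represented as characteristic functions
Letter : ℕ → Set
Letter n = Fin n → Bool

Trace : ℕ → Set
Trace n = ℕ → Letter n

-- quantifier-free body with m trace variables (de Bruijn indices Fin m)
data Body (n m : ℕ) : Set where
  atom  : Fin n → Fin m → Body n m
  neg   : Body n m → Body n m
  conj  : Body n m → Body n m → Body n m
  next  : Body n m → Body n m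
  until : Body n m → Body n m → Body n m

-- F φ = ⊤ U φ, with ⊤ expressed as the tautology ¬(φ ∧ ¬φ)
ev : ∀ {n m} → Body n m → Body n m
ev φ = until (neg (conj φ (neg φ))) φ

alw : ∀ {n m} → Body n m → Body n m
alw φ = neg (ev (neg φ))

data HForm (n : ℕ) : ℕ → Set where
  ex   : ∀ {m} → HForm n (suc m) → HForm n m
  all  : ∀ {m} → HForm n (suc m) → HForm n m
  body : ∀ {m} → Body n m → HForm n m

-- trace assignment: newest quantified variable is index zero
Assignment : ℕ → ℕ → Set
Assignment n m = Fin m → Trace n

extend : ∀ {n m} → Trace n → Assignment n m → Assignment n (suc m)
extend t Π zero    = t
extend t Π (suc x) = Π x

-- Π, i ⊨ φ : the body holds at position i (all traces shifted by i)
⟦_⟧ : ∀ {n m} → Body n m → Assignment n m → ℕ → Set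
⟦ atom a x ⟧    Π i = Π x i a ≡ true
⟦ neg φ ⟧       Π i = ¬ ⟦ φ ⟧ Π i
⟦ conj φ ψ ⟧    Π i = ⟦ φ ⟧ Π i × ⟦ ψ ⟧ Π i
⟦ next φ ⟧      Π i = ⟦ φ ⟧ Π (suc i)
⟦ until φ ψ ⟧   Π i =
  Σ ℕ λ j → i ≤ j × ⟦ ψ ⟧ Π j × (∀ l → i ≤ l → l < j → ⟦ φ ⟧ Π l)

TraceSet : ℕ → Set₁
TraceSet n = Trace n → Set

Sat : ∀ {n m} → TraceSet n → Assignment n m → HForm n m → Set
Sat {n} T Π (ex φ)   = Σ (Trace n) λ t → T t × Sat T (extend t Π) φ
Sat T Π (all φ)      = ∀ t → T t → Sat T (extend t Π) φ
Sat T Π (body φ)     = ⟦ φ ⟧ Π 0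

emptyAssignment : ∀ {n} → Assignment n 0
emptyAssignment ()

_⊨_ : ∀ {n} → TraceSet n → HForm n 0 → Set
T ⊨ φ = Sat T emptyAssignment φ

data XOnly {n m} : Body n m → Set where
  atom : ∀ a x → XOnly (atom a x)
  neg  : ∀ {φ} → XOnly φ → XOnly (neg φ)
  conj : ∀ {φ ψ} → XOnly φ → XOnly ψ → XOnly (conj φ ψ)
  next : ∀ {φ} → XOnly φ → XOnly (next φ)

data NoTemporal {n m} : Body n m → Set where
  atom : ∀ a x → NoTemporal (atom a x)
  neg  : ∀ {φ} → NoTemporal φ → NoTemporal (neg φ)
  conj : ∀ {φ ψ} → NoTemporal φ → NoTemporal ψ → NoTemporal (conj φ ψ)

existsN : ∀ {n} k {m} → HForm n (k + m) → HForm n m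
existsN zero    φ = φ
existsN (suc k) φ = existsN k (ex φ)

-- Variable index k is π (outermost ∀), indices k-1,…,0 are π₁,…,π_k.
record Instance : Set where
  field
    n       : ℕ
    k       : ℕ
    φ       : Body n (k + 1)
    φ'      : Body n (k + 1)
    φ-X     : XOnly φ
    φ'-noT  : NoTemporal φ'

formula : (I : Instance) → HForm (Instance.n I) 0
formula I = all (existsN k (body (conj (alw φ) φ')))
  where open Instance I

Satisfiable : Instance → Set₁
Satisfiable I = Σ (TraceSet (Instance.n I)) λ T →
  (Σ (Trace (Instance.n I)) T) × (T ⊨ formula I)

-- A coRE-complete problem: non-halting of 2-counter (Minsky) machines
-- started in state 0 with both counters 0.

data Instr (s : ℕ) : Set where
  inc  : Fin 2 → Fin s → Instr s
  jzd  : Fin 2 → Fin s → Fin s → Instr s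
  halt : Instr s

record Machine : Set where
  field
    states : ℕ
    prog   : Fin (suc states) → Instr (suc states)

Config : Machine → Set
Config M = Fin (suc (Machine.states M)) × ℕ × ℕ

step : (M : Machine) → Config M → Maybe (Config M)
step M (q , c₀ , c₁) with Machine.prog M q
... | inc zero l          = just (l , suc c₀ , c₁)
... | inc (suc _) l       = just (l , c₀ , suc c₁)
... | jzd zero l₁ l₂ with c₀
...   | zero  = just (l₁ , zero , c₁)
...   | suc c = just (l₂ , c , c₁)
step M (q , c₀ , c₁) | jzd (suc _) l₁ l₂ with c₁
...   | zero  = just (l₁ , c₀ , zero)
...   | suc c = just (l₂ , c₀ , c)
step M (q , c₀ , c₁) | halt = nothing

-- configuration after t steps (nothing = machine has halted)
run : (M : Machine) → ℕ → Maybe (Config M)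
run M zero    = just (zero , zero , zero)
run M (suc t) with run M t
... | nothing = nothing
... | just c  = step M c

Halts : Machine → Set
Halts M = Σ ℕ λ t → run M t ≡ nothing

-- coRE-hardness of a problem P over instances I: a (many-one) reduction
-- from the coRE-complete non-halting problem, given as an Agda function
-- (hence computable).
CoREHard : ∀ {ℓ} {I : Set} → (I → Set ℓ) → Set ℓ
CoREHard {I = I} P = Σ (Machine → I) λ f → ∀ M → (¬ Halts M) ⇔ P (f M)

-- Reduction from non-halting of two-counter machines. A configuration (q, m₀, m₁) is
-- encoded by a single trace: the state is a one-hot letter repeated forever and
-- counter j is unary, its bit being true exactly at the first m_j positions. Under
-- ∀π ∃π₁ ∃π₂, the X-only invariant forces π₁ to carry π's counters shifted by one
-- position, which increments or decrements a unary counter, and keeps π₁'s state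
-- constant; the position-0 part fixes that state and the incremented bit, and π₂ must
-- encode the initial configuration. A non-empty model therefore contains encodings of
-- all configurations along the run, so the run never halts; conversely, the encodings
-- of the configurations of a non-halting run form a model.
module Submission where

open import Data.Bool using (Bool; true; false)
import Data.Bool as Bool
open import Data.Bool.Properties using (T-≡; not-¬; ¬-not)
open import Data.Empty using (⊥-elim)
open import Data.Fin using (Fin; zero; suc; _≟_)
open import Data.Maybe using (Maybe; just; nothing)
open import Data.Nat using (ℕ; zero; suc; pred; z≤n; _<ᵇ_)
open import Data.Product using (Σ; _×_; _,_; proj₁; proj₂)
open import Function using (_∘_)
open import Function.Bundles using (_⇔_; mk⇔; Equivalence)
open import Relation.Binary.PropositionalEquality using (_≡_; _≗_; refl; sym; trans; subst)
open import Relation.Nullary using (¬_; Dec)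
open import Relation.Nullary.Decidable
  using (⌊_⌋; ¬?; _×-dec_; decidable-stable; toWitness; fromWitness)

open import Defs

private variable
  n m k : ℕ
  i : ℕ

_⇒ᵇ_ : Body n m → Body n m → Body n m
φ ⇒ᵇ ψ = neg (conj φ (neg ψ))

_⇔ᵇ_ : Body n m → Body n m → Body n m
φ ⇔ᵇ ψ = conj (φ ⇒ᵇ ψ) (ψ ⇒ᵇ φ)

⊤ᵇ : Body (suc n) (suc m)
⊤ᵇ = atom zero zero ⇒ᵇ atom zero zero

⋀ : (Fin k → Body (suc n) (suc m)) → Body (suc n) (suc m)
⋀ {k = zero}  φ = ⊤ᵇ
⋀ {k = suc k} φ = conj (φ zero) (⋀ (φ ∘ suc))

literal : Bool → Body n m → Body n m
literal true  φ = φ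
literal false φ = neg φ

XOnly-dec : {φ : Body n m} → XOnly φ → ∀ Π i → Dec (⟦ φ ⟧ Π i)
XOnly-dec (atom a x) Π i = Π x i a Bool.≟ true
XOnly-dec (neg p)    Π i = ¬? (XOnly-dec p Π i)
XOnly-dec (conj p q) Π i = XOnly-dec p Π i ×-dec XOnly-dec q Π i
XOnly-dec (next p)   Π i = XOnly-dec p Π (suc i)

NoTemporal⇒XOnly : {φ : Body n m} → NoTemporal φ → XOnly φ
NoTemporal⇒XOnly (atom a x) = atom a x
NoTemporal⇒XOnly (neg p)    = neg (NoTemporal⇒XOnly p)
NoTemporal⇒XOnly (conj p q) = conj (NoTemporal⇒XOnly p) (NoTemporal⇒XOnly q)

⇒ᵇ-NoTemporal : {φ ψ : Body n m} → NoTemporal φ → NoTemporal ψ → NoTemporal (φ ⇒ᵇ ψ)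
⇒ᵇ-NoTemporal φ ψ = neg (conj φ (neg ψ))

⇒ᵇ-XOnly : {φ ψ : Body n m} → XOnly φ → XOnly ψ → XOnly (φ ⇒ᵇ ψ)
⇒ᵇ-XOnly φ ψ = neg (conj φ (neg ψ))

⇔ᵇ-XOnly : {φ ψ : Body n m} → XOnly φ → XOnly ψ → XOnly (φ ⇔ᵇ ψ)
⇔ᵇ-XOnly φ ψ = conj (⇒ᵇ-XOnly φ ψ) (⇒ᵇ-XOnly ψ φ)

⊤ᵇ-NoTemporal : NoTemporal (⊤ᵇ {n} {m})
⊤ᵇ-NoTemporal = ⇒ᵇ-NoTemporal (atom zero zero) (atom zero zero)

⊤ᵇ-XOnly : XOnly (⊤ᵇ {n} {m})
⊤ᵇ-XOnly = NoTemporal⇒XOnly ⊤ᵇ-NoTemporal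

⊤ᵇ-holds : ∀ (Π : Assignment (suc n) (suc m)) i → ⟦ ⊤ᵇ ⟧ Π i
⊤ᵇ-holds Π i (a , ¬a) = ¬a a

⇒ᵇ-elim : ∀ {φ ψ : Body n m} {Π} → XOnly ψ → ⟦ φ ⇒ᵇ ψ ⟧ Π i → ⟦ φ ⟧ Π i → ⟦ ψ ⟧ Π i
⇒ᵇ-elim {i = i} {Π = Π} ψ-X φ⇒ψ φ = decidable-stable (XOnly-dec ψ-X Π i) (λ ¬ψ → φ⇒ψ (φ , ¬ψ))

⋀-elim : ∀ {φ : Fin k → Body (suc n) (suc m)} {Π} → ⟦ ⋀ φ ⟧ Π i → ∀ p → ⟦ φ p ⟧ Π i
⋀-elim {k = suc k} (φ₀ , _)  zero    = φ₀
⋀-elim {k = suc k} (_ , φₛ) (suc p) = ⋀-elim φₛ p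

⋀-intro : ∀ {φ : Fin k → Body (suc n) (suc m)} {Π} → (∀ p → ⟦ φ p ⟧ Π i) → ⟦ ⋀ φ ⟧ Π i
⋀-intro {k = zero}  {i = i} {Π = Π} _ = ⊤ᵇ-holds Π i
⋀-intro {k = suc k} φ = φ zero , ⋀-intro (φ ∘ suc)

⋀-XOnly : {φ : Fin k → Body (suc n) (suc m)} → (∀ p → XOnly (φ p)) → XOnly (⋀ φ)
⋀-XOnly {k = zero}  _ = ⊤ᵇ-XOnly
⋀-XOnly {k = suc k} φ = conj (φ zero) (⋀-XOnly (φ ∘ suc))

⋀-NoTemporal : {φ : Fin k → Body (suc n) (suc m)} → (∀ p → NoTemporal (φ p)) → NoTemporal (⋀ φ)
⋀-NoTemporal {k = zero}  _ = ⊤ᵇ-NoTemporal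
⋀-NoTemporal {k = suc k} φ = conj (φ zero) (⋀-NoTemporal (φ ∘ suc))

literal-NoTemporal : ∀ b {φ : Body n m} → NoTemporal φ → NoTemporal (literal b φ)
literal-NoTemporal true  φ = φ
literal-NoTemporal false φ = neg φ

literal-atom : ∀ b {a x} {Π : Assignment n m} → ⟦ literal b (atom a x) ⟧ Π i ⇔ (Π x i a ≡ b)
literal-atom true  = mk⇔ (λ v → v) (λ v → v)
literal-atom false = mk⇔ ¬-not not-¬

alw-elim : ∀ {φ : Body n m} {Π} → XOnly φ → ⟦ alw φ ⟧ Π 0 → ∀ i → ⟦ φ ⟧ Π i
alw-elim {Π = Π} φ-X □φ i =
  decidable-stable (XOnly-dec φ-X Π i) (λ ¬φ → □φ (i , z≤n , ¬φ , λ _ _ _ (⊤ , ¬⊤) → ¬⊤ ⊤))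

alw-intro : ∀ {φ : Body n m} {Π} → (∀ i → ⟦ φ ⟧ Π i) → ⟦ alw φ ⟧ Π 0
alw-intro φ (i , _ , ¬φ , _) = ¬φ (φ i)

-- the meaning of  φ ⇔ᵇ ψ  for atomic φ and ψ
_⇔ᵀ_ : Bool → Bool → Set
a ⇔ᵀ b = ¬ (a ≡ true × ¬ b ≡ true) × ¬ (b ≡ true × ¬ a ≡ true)

⇔ᵀ⇒≡ : ∀ {a b} → a ⇔ᵀ b → a ≡ b
⇔ᵀ⇒≡ {true}  {true}  _         = refl
⇔ᵀ⇒≡ {true}  {false} (a⇒b , _) = ⊥-elim (a⇒b (refl , λ ()))
⇔ᵀ⇒≡ {false} {true}  (_ , b⇒a) = ⊥-elim (b⇒a (refl , λ ()))
⇔ᵀ⇒≡ {false} {false} _         = refl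

⇔ᵀ-refl : ∀ {a} → a ⇔ᵀ a
⇔ᵀ-refl = (λ (a , ¬a) → ¬a a) , (λ (a , ¬a) → ¬a a)

isYes-true : ∀ {A : Set} (a? : Dec A) → A → ⌊ a? ⌋ ≡ true
isYes-true a? a = Equivalence.to T-≡ (fromWitness a)

isYes-true⇒ : ∀ {A : Set} (a? : Dec A) → ⌊ a? ⌋ ≡ true → A
isYes-true⇒ a? e = toWitness (Equivalence.from T-≡ e)

record Unary (b : ℕ → Bool) (c : ℕ) : Set where
  constructor unary
  field bit : ∀ i → b i ≡ (i <ᵇ c)
open Unary

unary-resp : ∀ {b b′ c} → b ≗ b′ → Unary b′ c → Unary b c
unary-resp b≗b′ u = unary λ i → trans (b≗b′ i) (bit u i)

unary-suc : ∀ {b b′ c} → b 0 ≡ true → b ∘ suc ≗ b′ → Unary b′ c → Unary b (suc c)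
unary-suc {b} {b′} {c} b₀ b≗b′ u = unary bits
  where
  bits : ∀ i → b i ≡ (i <ᵇ suc c)
  bits zero    = b₀
  bits (suc i) = trans (b≗b′ i) (bit u i)

-- pred 0 = 0, so this also covers the zero branch of jzd
unary-pred : ∀ {b b′ c} → b ≗ b′ ∘ suc → Unary b′ c → Unary b (pred c)
unary-pred {c = zero}  b≗b′ u = unary λ i → trans (b≗b′ i) (bit u (suc i))
unary-pred {c = suc c} b≗b′ u = unary λ i → trans (b≗b′ i) (bit u (suc i))

module Reduction (M : Machine) where
  open Machine M using (states; prog)

  S : ℕ
  S = suc states

  stepInstr : Instr S → Config M → Maybe (Config M)
  stepInstr (inc zero l)        (q , m₀ , m₁)     = just (l , suc m₀ , m₁)
  stepInstr (inc (suc _) l)     (q , m₀ , m₁)     = just (l , m₀ , suc m₁)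
  stepInstr (jzd zero l₁ l₂)    (q , zero , m₁)   = just (l₁ , zero , m₁)
  stepInstr (jzd zero l₁ l₂)    (q , suc m₀ , m₁) = just (l₂ , m₀ , m₁)
  stepInstr (jzd (suc _) l₁ l₂) (q , m₀ , zero)   = just (l₁ , m₀ , zero)
  stepInstr (jzd (suc _) l₁ l₂) (q , m₀ , suc m₁) = just (l₂ , m₀ , m₁)
  stepInstr halt                _                 = nothing

  step-≡-stepInstr : ∀ q m₀ m₁ → step M (q , m₀ , m₁) ≡ stepInstr (prog q) (q , m₀ , m₁)
  step-≡-stepInstr q m₀ m₁ with prog q
  ... | inc zero l        = refl
  ... | inc (suc _) l     = refl
  ... | jzd zero l₁ l₂ with m₀
  ...   | zero  = refl
  ...   | suc _ = refl
  step-≡-stepInstr q m₀ m₁ | jzd (suc _) l₁ l₂ with m₁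
  ...   | zero  = refl
  ...   | suc _ = refl
  step-≡-stepInstr q m₀ m₁ | halt = refl

  _↦_ : Config M → Config M → Set
  c ↦ c′ = stepInstr (prog (proj₁ c)) c ≡ just c′

  run-suc : ∀ t {q m₀ m₁} → run M t ≡ just (q , m₀ , m₁) →
            run M (suc t) ≡ stepInstr (prog q) (q , m₀ , m₁)
  run-suc t {q} {m₀} {m₁} e rewrite e = step-≡-stepInstr q m₀ m₁

  run-successor : ¬ Halts M → ∀ t {c} → run M t ≡ just c →
                  Σ (Config M) λ c′ → run M (suc t) ≡ just c′ × c ↦ c′
  run-successor ¬halts t {c} e with stepInstr (prog (proj₁ c)) c in s
  ... | nothing = ⊥-elim (¬halts (suc t , trans (run-suc t e) s))
  ... | just c′ = c′ , trans (run-suc t e) s , refl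

  initial : Config M
  initial = zero , 0 , 0

  N : ℕ
  N = suc (suc S)

  counterAtom : Fin 2 → Fin N
  counterAtom zero    = zero
  counterAtom (suc _) = suc zero

  other : Fin 2 → Fin 2
  other zero    = suc zero
  other (suc _) = zero

  stateAtom : Fin S → Fin N
  stateAtom q = suc (suc q)

  encode : Config M → Trace N
  encode (q , m₀ , m₁) i zero          = i <ᵇ m₀
  encode (q , m₀ , m₁) i (suc zero)    = i <ᵇ m₁
  encode (q , m₀ , m₁) i (suc (suc p)) = ⌊ p ≟ q ⌋

  InStateAt : Trace N → ℕ → Fin S → Set
  InStateAt u i q = ∀ p → u i (stateAtom p) ≡ ⌊ p ≟ q ⌋

  counterTrack : Trace N → Fin 2 → ℕ → Bool
  counterTrack u j i = u i (counterAtom j)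

  Encodes : Trace N → Config M → Set
  Encodes u (q , m₀ , m₁) =
    (∀ i → InStateAt u i q) × Unary (counterTrack u zero) m₀ × Unary (counterTrack u (suc zero)) m₁

  -- de Bruijn indices of the variables of ∀π ∃π₁ ∃π₂; π₁ is to encode the successor
  -- of the configuration encoded by π, and π₂ the initial configuration
  π π₁ π₂ : Fin 3
  π  = suc (suc zero)
  π₁ = suc zero
  π₂ = zero

  assign : Trace N → Trace N → Trace N → Assignment N 3
  assign u u₁ u₂ = extend u₂ (extend u₁ (extend u emptyAssignment))

  Form : Set
  Form = Body N 3

  stateLiteral : Fin S → Fin 3 → Fin S → Form
  stateLiteral q x p = literal ⌊ p ≟ q ⌋ (atom (stateAtom p) x)

  inState : Fin S → Fin 3 → Form
  inState q x = ⋀ (stateLiteral q x)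

  guarded : (Fin S → Form) → Fin S → Form
  guarded ψ q = atom (stateAtom q) π ⇒ᵇ ψ q

  onState : (Fin S → Form) → Form
  onState ψ = ⋀ (guarded ψ)

  sameCounter : Fin 2 → Form
  sameCounter j = atom (counterAtom j) π₁ ⇔ᵇ atom (counterAtom j) π

  counterUpdate : Instr S → Form
  counterUpdate (inc j _)   =
    conj (next (atom (counterAtom j) π₁) ⇔ᵇ atom (counterAtom j) π) (sameCounter (other j))
  counterUpdate (jzd j _ _) =
    conj (atom (counterAtom j) π₁ ⇔ᵇ next (atom (counterAtom j) π)) (sameCounter (other j))
  counterUpdate halt        = ⊤ᵇ

  jumpTarget : Instr S → Form
  jumpTarget (inc j l)     = conj (atom (counterAtom j) π₁) (inState l π₁)
  jumpTarget (jzd j l₁ l₂) = conj (neg (atom (counterAtom j) π) ⇒ᵇ inState l₁ π₁)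
                                  (atom (counterAtom j) π ⇒ᵇ inState l₂ π₁)
  jumpTarget halt          = neg ⊤ᵇ

  isInitial : Form
  isInitial = conj (neg (atom (counterAtom zero) π₂))
                   (conj (neg (atom (counterAtom (suc zero)) π₂)) (inState zero π₂))

  stateStable : Fin S → Form
  stateStable p = atom (stateAtom p) π₁ ⇔ᵇ next (atom (stateAtom p) π₁)

  globalPart : Form
  globalPart = conj isInitial (conj (⋀ stateStable) (onState (counterUpdate ∘ prog)))

  initialPart : Form
  initialPart = onState (jumpTarget ∘ prog)

  inState-NoTemporal : ∀ q x → NoTemporal (inState q x)
  inState-NoTemporal q x = ⋀-NoTemporal λ p → literal-NoTemporal ⌊ p ≟ q ⌋ (atom (stateAtom p) x)

  inState-XOnly : ∀ q x → XOnly (inState q x)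
  inState-XOnly q x = NoTemporal⇒XOnly (inState-NoTemporal q x)

  counterUpdate-XOnly : ∀ ins → XOnly (counterUpdate ins)
  counterUpdate-XOnly (inc j _)   =
    conj (⇔ᵇ-XOnly (next (atom _ _)) (atom _ _)) (⇔ᵇ-XOnly (atom _ _) (atom _ _))
  counterUpdate-XOnly (jzd j _ _) =
    conj (⇔ᵇ-XOnly (atom _ _) (next (atom _ _))) (⇔ᵇ-XOnly (atom _ _) (atom _ _))
  counterUpdate-XOnly halt        = ⊤ᵇ-XOnly

  jumpTarget-NoTemporal : ∀ ins → NoTemporal (jumpTarget ins)
  jumpTarget-NoTemporal (inc j l)     = conj (atom _ _) (inState-NoTemporal l π₁)
  jumpTarget-NoTemporal (jzd j l₁ l₂) =
    conj (⇒ᵇ-NoTemporal (neg (atom _ _)) (inState-NoTemporal l₁ π₁))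
         (⇒ᵇ-NoTemporal (atom _ _) (inState-NoTemporal l₂ π₁))
  jumpTarget-NoTemporal halt          = neg ⊤ᵇ-NoTemporal

  jumpTarget-XOnly : ∀ ins → XOnly (jumpTarget ins)
  jumpTarget-XOnly = NoTemporal⇒XOnly ∘ jumpTarget-NoTemporal

  globalPart-XOnly : XOnly globalPart
  globalPart-XOnly =
    conj (conj (neg (atom _ _)) (conj (neg (atom _ _)) (inState-XOnly zero π₂)))
         (conj (⋀-XOnly λ p → ⇔ᵇ-XOnly (atom (stateAtom p) π₁) (next (atom (stateAtom p) π₁)))
               (⋀-XOnly λ q → ⇒ᵇ-XOnly (atom (stateAtom q) π) (counterUpdate-XOnly (prog q))))

  initialPart-NoTemporal : NoTemporal initialPart
  initialPart-NoTemporal =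
    ⋀-NoTemporal λ q → ⇒ᵇ-NoTemporal (atom (stateAtom q) π) (jumpTarget-NoTemporal (prog q))

  reduction : Instance
  reduction = record
    { n = N ; k = 2 ; φ = globalPart ; φ' = initialPart
    ; φ-X = globalPart-XOnly ; φ'-noT = initialPart-NoTemporal }

  inState-elim : ∀ {q x Π} → ⟦ inState q x ⟧ Π i → InStateAt (Π x) i q
  inState-elim {q = q} {x} h p =
    Equivalence.to (literal-atom ⌊ p ≟ q ⌋) (⋀-elim {φ = stateLiteral q x} h p)

  inState-intro : ∀ {q x Π} → InStateAt (Π x) i q → ⟦ inState q x ⟧ Π i
  inState-intro {q = q} {x} h =
    ⋀-intro {φ = stateLiteral q x} λ p → Equivalence.from (literal-atom ⌊ p ≟ q ⌋) (h p)

  onState-elim : ∀ {ψ q Π} → XOnly (ψ q) → InStateAt (Π π) i q → ⟦ onState ψ ⟧ Π i → ⟦ ψ q ⟧ Π i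
  onState-elim {ψ = ψ} {q} ψ-X inQ h =
    ⇒ᵇ-elim {φ = atom (stateAtom q) π} ψ-X (⋀-elim {φ = guarded ψ} h q)
            (trans (inQ q) (isYes-true (q ≟ q) refl))

  onState-intro : ∀ {ψ q Π} → InStateAt (Π π) i q → ⟦ ψ q ⟧ Π i → ⟦ onState ψ ⟧ Π i
  onState-intro {i = i} {ψ} {q} {Π} inQ ψq = ⋀-intro {φ = guarded ψ} λ p (inP , ¬ψp) →
    ¬ψp (subst (λ p → ⟦ ψ p ⟧ Π i) (sym (isYes-true⇒ (p ≟ q) (trans (sym (inQ p)) inP))) ψq)

  stateConstant : ∀ {q Π} → (∀ i → ⟦ ⋀ stateStable ⟧ Π i) → ⟦ inState q π₁ ⟧ Π 0 →
                  ∀ i → InStateAt (Π π₁) i q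
  stateConstant K q₀ zero    = inState-elim q₀
  stateConstant K q₀ (suc i) p =
    trans (sym (⇔ᵀ⇒≡ (⋀-elim {φ = stateStable} (K i) p))) (stateConstant K q₀ i p)

  isInitial-elim : ∀ {Π} → (∀ i → ⟦ isInitial ⟧ Π i) → Encodes (Π π₂) initial
  isInitial-elim I = (λ i → inState-elim (proj₂ (proj₂ (I i))))
                   , unary (λ i → ¬-not (proj₁ (I i)))
                   , unary (λ i → ¬-not (proj₁ (proj₂ (I i))))

  jumpTarget-zero : ∀ {j l₁ l₂ Π} → counterTrack (Π π) j 0 ≡ false →
                    ⟦ jumpTarget (jzd j l₁ l₂) ⟧ Π 0 → ⟦ inState l₁ π₁ ⟧ Π 0
  jumpTarget-zero {j} {l₁} isZero (ifZero , _) =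
    ⇒ᵇ-elim {φ = neg (atom (counterAtom j) π)} (inState-XOnly l₁ π₁) ifZero (not-¬ isZero)

  jumpTarget-positive : ∀ {j l₁ l₂ Π} → counterTrack (Π π) j 0 ≡ true →
                        ⟦ jumpTarget (jzd j l₁ l₂) ⟧ Π 0 → ⟦ inState l₂ π₁ ⟧ Π 0
  jumpTarget-positive {j} {l₁} {l₂} isPositive (_ , ifPositive) =
    ⇒ᵇ-elim {φ = atom (counterAtom j) π} (inState-XOnly l₂ π₁) ifPositive isPositive

  instr-successor : ∀ {Π} ins c → Encodes (Π π) c →
                    (∀ i → ⟦ counterUpdate ins ⟧ Π i) → ⟦ jumpTarget ins ⟧ Π 0 →
                    (∀ i → ⟦ ⋀ stateStable ⟧ Π i) →
                    Σ (Config M) λ c′ → stepInstr ins c ≡ just c′ × Encodes (Π π₁) c′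
  instr-successor (inc zero l) (q , m₀ , m₁) (_ , u₀ , u₁) U (bit₀ , target) K =
    (l , suc m₀ , m₁) , refl , stateConstant K target ,
    unary-suc bit₀ (⇔ᵀ⇒≡ ∘ proj₁ ∘ U) u₀ , unary-resp (⇔ᵀ⇒≡ ∘ proj₂ ∘ U) u₁
  instr-successor (inc (suc _) l) (q , m₀ , m₁) (_ , u₀ , u₁) U (bit₀ , target) K =
    (l , m₀ , suc m₁) , refl , stateConstant K target ,
    unary-resp (⇔ᵀ⇒≡ ∘ proj₂ ∘ U) u₀ , unary-suc bit₀ (⇔ᵀ⇒≡ ∘ proj₁ ∘ U) u₁
  instr-successor (jzd zero l₁ l₂) (q , zero , m₁) (_ , u₀ , u₁) U J K =
    (l₁ , zero , m₁) , refl , stateConstant K (jumpTarget-zero (bit u₀ 0) J) ,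
    unary-pred (⇔ᵀ⇒≡ ∘ proj₁ ∘ U) u₀ , unary-resp (⇔ᵀ⇒≡ ∘ proj₂ ∘ U) u₁
  instr-successor (jzd zero l₁ l₂) (q , suc m₀ , m₁) (_ , u₀ , u₁) U J K =
    (l₂ , m₀ , m₁) , refl , stateConstant K (jumpTarget-positive (bit u₀ 0) J) ,
    unary-pred (⇔ᵀ⇒≡ ∘ proj₁ ∘ U) u₀ , unary-resp (⇔ᵀ⇒≡ ∘ proj₂ ∘ U) u₁
  instr-successor (jzd (suc j) l₁ l₂) (q , m₀ , zero) (_ , u₀ , u₁) U J K =
    (l₁ , m₀ , zero) , refl , stateConstant K (jumpTarget-zero {j = suc j} (bit u₁ 0) J) ,
    unary-resp (⇔ᵀ⇒≡ ∘ proj₂ ∘ U) u₀ , unary-pred (⇔ᵀ⇒≡ ∘ proj₁ ∘ U) u₁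
  instr-successor (jzd (suc j) l₁ l₂) (q , m₀ , suc m₁) (_ , u₀ , u₁) U J K =
    (l₂ , m₀ , m₁) , refl , stateConstant K (jumpTarget-positive {j = suc j} (bit u₁ 0) J) ,
    unary-resp (⇔ᵀ⇒≡ ∘ proj₂ ∘ U) u₀ , unary-pred (⇔ᵀ⇒≡ ∘ proj₁ ∘ U) u₁
  instr-successor {Π} halt _ _ _ halted _ = ⊥-elim (halted (⊤ᵇ-holds Π 0))

  successor : ∀ {Π} c → Encodes (Π π) c → (∀ i → ⟦ globalPart ⟧ Π i) → ⟦ initialPart ⟧ Π 0 →
              Σ (Config M) λ c′ → c ↦ c′ × Encodes (Π π₁) c′
  successor c@(q , _) enc G Z =
    instr-successor (prog q) c enc
      (λ i → onState-elim {ψ = counterUpdate ∘ prog} (counterUpdate-XOnly (prog q)) (proj₁ enc i)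
                          (proj₂ (proj₂ (G i))))
      (onState-elim {ψ = jumpTarget ∘ prog} (jumpTarget-XOnly (prog q)) (proj₁ enc 0) Z)
      (proj₁ ∘ proj₂ ∘ G)

  module Soundness (T : TraceSet N) (model : T ⊨ formula reduction) where

    initial-in-model : ∀ {u} → T u → Σ (Trace N) λ u′ → T u′ × Encodes u′ initial
    initial-in-model Tu with model _ Tu
    ... | u₁ , _ , u₂ , Tu₂ , □G , _ =
      u₂ , Tu₂ , isInitial-elim (proj₁ ∘ alw-elim globalPart-XOnly □G)

    successor-in-model : ∀ {u} c → T u → Encodes u c →
                         Σ (Config M) λ c′ → c ↦ c′ × Σ (Trace N) λ u′ → T u′ × Encodes u′ c′
    successor-in-model {u} c Tu enc with model u Tu
    ... | u₁ , Tu₁ , u₂ , _ , □G , Z with successor c enc (alw-elim globalPart-XOnly □G) Z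
    ...   | c′ , s , enc′ = c′ , s , u₁ , Tu₁ , enc′

    Reachable : ℕ → Set
    Reachable t = Σ (Config M) λ c → run M t ≡ just c × Σ (Trace N) λ u → T u × Encodes u c

    reachable : Σ (Trace N) T → ∀ t → Reachable t
    reachable (_ , Tu) zero = initial , refl , initial-in-model Tu
    reachable u₀ (suc t) with reachable u₀ t
    ... | c , run-t , u , Tu , enc with successor-in-model c Tu enc
    ...   | c′ , s , rest = c′ , trans (run-suc t run-t) s , rest

    never-halts : Σ (Trace N) T → ¬ Halts M
    never-halts u₀ (t , halted) with reachable u₀ t
    ... | _ , running , _ with trans (sym halted) running
    ...   | ()

  encoded : Config M → Config M → Assignment N 3
  encoded c c′ = assign (encode c) (encode c′) (encode initial)

  counterUpdate-encode : ∀ ins c {c′} → stepInstr ins c ≡ just c′ →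
                         ∀ i → ⟦ counterUpdate ins ⟧ (encoded c c′) i
  counterUpdate-encode (inc zero l)        (q , m₀ , m₁)     refl i = ⇔ᵀ-refl , ⇔ᵀ-refl
  counterUpdate-encode (inc (suc _) l)     (q , m₀ , m₁)     refl i = ⇔ᵀ-refl , ⇔ᵀ-refl
  counterUpdate-encode (jzd zero l₁ l₂)    (q , zero , m₁)   refl i = ⇔ᵀ-refl , ⇔ᵀ-refl
  counterUpdate-encode (jzd zero l₁ l₂)    (q , suc m₀ , m₁) refl i = ⇔ᵀ-refl , ⇔ᵀ-refl
  counterUpdate-encode (jzd (suc _) l₁ l₂) (q , m₀ , zero)   refl i = ⇔ᵀ-refl , ⇔ᵀ-refl
  counterUpdate-encode (jzd (suc _) l₁ l₂) (q , m₀ , suc m₁) refl i = ⇔ᵀ-refl , ⇔ᵀ-refl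

  jumpTarget-encode : ∀ ins c {c′} → stepInstr ins c ≡ just c′ → ⟦ jumpTarget ins ⟧ (encoded c c′) 0
  jumpTarget-encode (inc zero l)        (q , m₀ , m₁)     refl = refl , inState-intro (λ p → refl)
  jumpTarget-encode (inc (suc _) l)     (q , m₀ , m₁)     refl = refl , inState-intro (λ p → refl)
  jumpTarget-encode (jzd zero l₁ l₂)    (q , zero , m₁)   refl =
    (λ (_ , ¬target) → ¬target (inState-intro (λ p → refl))) , λ { (() , _) }
  jumpTarget-encode (jzd zero l₁ l₂)    (q , suc m₀ , m₁) refl =
    (λ (positive , _) → positive refl) , λ (_ , ¬target) → ¬target (inState-intro (λ p → refl))
  jumpTarget-encode (jzd (suc _) l₁ l₂) (q , m₀ , zero)   refl =
    (λ (_ , ¬target) → ¬target (inState-intro (λ p → refl))) , λ { (() , _) }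
  jumpTarget-encode (jzd (suc _) l₁ l₂) (q , m₀ , suc m₁) refl =
    (λ (positive , _) → positive refl) , λ (_ , ¬target) → ¬target (inState-intro (λ p → refl))

  encode-satisfies : ∀ c {c′} → c ↦ c′ →
                     ⟦ alw globalPart ⟧ (encoded c c′) 0 × ⟦ initialPart ⟧ (encoded c c′) 0
  encode-satisfies c@(q , _) s =
    alw-intro {φ = globalPart} (λ i →
      ((λ ()) , (λ ()) , inState-intro {q = zero} {x = π₂} (λ p → refl)) ,
      ⋀-intro {φ = stateStable} (λ p → ⇔ᵀ-refl) ,
      onState-intro {ψ = counterUpdate ∘ prog} {q = q} (λ p → refl)
                    (counterUpdate-encode (prog q) c s i)) ,
    onState-intro {ψ = jumpTarget ∘ prog} {q = q} (λ p → refl) (jumpTarget-encode (prog q) c s)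

  module Completeness (¬halts : ¬ Halts M) where

    Reached : TraceSet N
    Reached u = Σ ℕ λ t → Σ (Config M) λ c → run M t ≡ just c × u ≡ encode c

    model : Reached ⊨ formula reduction
    model _ (t , c , run-t , refl) with run-successor ¬halts t run-t
    ... | c′ , run-suc-t , s =
      encode c′ , (suc t , c′ , run-suc-t , refl) , encode initial , (0 , initial , refl , refl) ,
      encode-satisfies c s

    satisfiable : Satisfiable reduction
    satisfiable = Reached , (encode initial , 0 , initial , refl , refl) , model

  ¬halts⇔satisfiable : (¬ Halts M) ⇔ Satisfiable reduction
  ¬halts⇔satisfiable =
    mk⇔ Completeness.satisfiable λ (T , u₀ , model) → Soundness.never-halts T model u₀

lemma3p10 : CoREHard Satisfiable
lemma3p10 = Reduction.reduction , Reduction.¬halts⇔satisfiable
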